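{- Let $n\ge 2$ and $k\ge 0$ be integers, let $G$ be a simple graph of order $n$, and let $\bar G$ be its complement. Then (1) $3\le \alpha_{k-reg}(G)+\alpha_{k-reg}(\bar G)\le 2n$; (2) $2\le \alpha_{k-reg}(G)\cdot\alpha_{k-reg}(\bar G)\le n^2$.
   Context: All graphs are finite, simple and undirected. For a graph $G$ and an integer $i\ge 0$, $D_i(G)$ denotes the set of vertices of degree $i$ in $G$. For an integer $k\ge 0$, a set $S\subseteq V(G)$ is $k$-independent if the induced subgraph $G[S]$ has maximum degree at most $k$. A regular $k$-independent set is a $k$-independent set $S$ with $S\subseteq D_i(G)$ for some $i$. The regular $k$-independence number $\alpha_{k-reg}(G)$ is the maximum cardinality of a regular $k$-independent set of $G$. -}

module Defs where

open import Data.Nat using (ℕ; _≤_)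
open import Data.Bool using (Bool; true; false; not; T)
open import Data.Fin using (Fin)
open import Data.Fin.Subset using (Subset; _∈_; _⊆_; ∣_∣)
open import Data.Vec using (tabulate; countᵇ)
open import Data.Product using (Σ; _×_)
open import Relation.Binary.PropositionalEquality using (_≡_)

record Graph (n : ℕ) : Set where
  field
    adj   : Fin n → Fin n → Bool
    adj-sym : ∀ u v → adj u v ≡ adj v u
    adj-irrefl : ∀ v → adj v v ≡ false

open Graph public

open import Data.Fin using (_≟_)
open import Relation.Nullary using (does)
open import Data.Bool using (_∧_)
open import Relation.Binary.PropositionalEquality using (refl; cong₂; sym)

complement : ∀ {n} → Graph n → Graph n
complement {n} G = record
  { adj = λ u v → not (does (u ≟ v)) ∧ not (adj G u v)
  ; adj-sym = λ u v → cong₂ (λ a b → not a ∧ not b) (eq u v) (adj-sym G u v)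
  ; adj-irrefl = λ v → help v
  }
  where
    eq : ∀ (u v : Fin n) → does (u ≟ v) ≡ does (v ≟ u)
    eq u v with u ≟ v | v ≟ u
    ... | Relation.Nullary.yes _ | Relation.Nullary.yes _ = refl
    ... | Relation.Nullary.no _  | Relation.Nullary.no _  = refl
    ... | Relation.Nullary.yes p | Relation.Nullary.no q  = Data.Empty.⊥-elim (q (sym p))
      where import Data.Empty
    ... | Relation.Nullary.no p  | Relation.Nullary.yes q = Data.Empty.⊥-elim (p (sym q))
      where import Data.Empty
    help : ∀ (v : Fin n) → not (does (v ≟ v)) ∧ not (adj G v v) ≡ false
    help v with v ≟ v
    ... | Relation.Nullary.yes _ = refl
    ... | Relation.Nullary.no ¬p = Data.Empty.⊥-elim (¬p refl)
      where import Data.Empty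

open import Data.Vec using (allFin)

degree : ∀ {n} → Graph n → Fin n → ℕ
degree G v = countᵇ (adj G v) (allFin _)

open import Data.Fin.Subset using (Side; inside; outside)
open import Data.Vec using (lookup)

inS : ∀ {n} → Subset n → Fin n → Bool
inS S u with lookup S u
... | inside  = true
... | outside = false

degreeIn : ∀ {n} → Graph n → Subset n → Fin n → ℕ
degreeIn G S v = countᵇ (λ u → inS S u ∧ adj G v u) (allFin _)

KIndependent : ∀ {n} → Graph n → ℕ → Subset n → Set
KIndependent G k S = ∀ v → v ∈ S → degreeIn G S v ≤ k

InDegreeClass : ∀ {n} → Graph n → ℕ → Subset n → Set
InDegreeClass G i S = ∀ v → v ∈ S → degree G v ≡ i

RegularKIndependent : ∀ {n} → Graph n → ℕ → Subset n → Set
RegularKIndependent G k S = KIndependent G k S × Σ ℕ (λ i → InDegreeClass G i S)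

IsRegKIndepNumber : ∀ {n} → Graph n → ℕ → ℕ → Set
IsRegKIndepNumber G k m =
  Σ (Subset _) (λ S → RegularKIndependent G k S × ∣ S ∣ ≡ m)
  × (∀ S → RegularKIndependent G k S → ∣ S ∣ ≤ m)

-- A singleton is a regular k-independent set, so both numbers lie between 1 and n.
-- Since degrees 0 and n - 1 cannot occur together, two vertices u ≠ v have the same
-- degree. If they are non-adjacent, {u, v} is regular k-independent in G; otherwise
-- it is so in the complement, where every degree d becomes n - 1 - d. Hence one of
-- the two numbers is at least 2.
module Submission where

open import Data.Bool using (Bool; true; false; not; _∧_; _∨_)
open import Data.Bool.Properties using (∨-∧-booleanAlgebra; ∧-zeroʳ; ∧-conicalˡ; ∧-conicalʳ)
open import Algebra.Lattice.Properties.BooleanAlgebra ∨-∧-booleanAlgebra using (deMorgan₂)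
open import Data.Empty using (⊥-elim)
open import Data.Fin using (Fin; zero; suc; _≟_; toℕ; fromℕ<)
import Data.Fin as Fin
open import Data.Fin.Properties using (any?; pigeonhole; toℕ-fromℕ<)
open import Data.Fin.Subset
  using (Subset; inside; outside; _∈_; _∉_; _⊆_; ∣_∣; ⁅_⁆; _∪_; _∩_; ∁; ⊥; Empty)
open import Data.Fin.Subset.Properties
  using (∣p∣≤n; ∣⊥∣≡0; ∣⁅x⁆∣≡1; ∣∁p∣≡n∸∣p∣; ∣p∣≤∣p∪q∣; p⊆q⇒∣p∣≤∣q∣; drop-∷-Empty;
         x∈⁅y⁆⇒x≡y; x∈p∩q⁻; x∈p∪q⁻)
open import Data.Nat using (ℕ; zero; suc; _≤_; _<_; _+_; _*_; _∸_; z≤n; s≤s; s≤s⁻¹)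
  renaming (_≟_ to _≟ℕ_)
open import Data.Nat.Properties
  using (≤-trans; <-irrefl; +-suc; +-identityʳ; +-mono-≤; *-mono-≤; n≢0⇒n>0;
         n<1+n; m+n∸m≡n; ∸-monoˡ-<; ∸-cancelʳ-≡)
open import Data.Product using (∃₂; _×_; _,_; proj₁; proj₂)
open import Data.Sum using (_⊎_; inj₁; inj₂)
import Data.Sum as Sum
open import Data.Vec using (_∷_; []; here; tabulate; countᵇ; lookup)
open import Data.Vec.Properties
  using (lookup⇒[]=; []=⇒lookup; lookup∘tabulate; tabulate∘lookup; tabulate-cong;
         lookup-map; lookup-zipWith; lookup-replicate)
open import Function using (_∘_; id)
open import Relation.Binary.PropositionalEquality
open import Relation.Nullary using (does; yes; no)

open import Defs

private
  variable
    n : ℕ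

countᵇ-tabulate : ∀ {A : Set} (p : A → Bool) (f : Fin n → A) →
                  countᵇ p (tabulate f) ≡ ∣ tabulate (p ∘ f) ∣
countᵇ-tabulate {n = zero}  p f = refl
countᵇ-tabulate {n = suc n} p f with p (f zero)
... | true  = cong suc (countᵇ-tabulate p (f ∘ suc))
... | false = countᵇ-tabulate p (f ∘ suc)

x∈tabulate⇒ : ∀ {p : Fin n → Bool} {x} → x ∈ tabulate p → p x ≡ true
x∈tabulate⇒ {p = p} {x} x∈ = trans (sym (lookup∘tabulate p x)) ([]=⇒lookup x∈)

inS⇒∈ : ∀ {S : Subset n} {u} → inS S u ≡ true → u ∈ S
inS⇒∈ {S = S} {u} _ with lookup S u in eq
... | true = lookup⇒[]= u S eq

x∈p⇒0<∣p∣ : ∀ {p : Subset n} {x} → x ∈ p → 0 < ∣ p ∣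
x∈p⇒0<∣p∣ {p = p} {x} x∈p =
  subst (_≤ ∣ p ∣) (∣⁅x⁆∣≡1 x)
        (p⊆q⇒∣p∣≤∣q∣ λ y∈⁅x⁆ → subst (_∈ p) (sym (x∈⁅y⁆⇒x≡y x y∈⁅x⁆)) x∈p)

∣p∪q∣≡∣p∣+∣q∣ : ∀ (p q : Subset n) → Empty (p ∩ q) → ∣ p ∪ q ∣ ≡ ∣ p ∣ + ∣ q ∣
∣p∪q∣≡∣p∣+∣q∣ []            []            _ = refl
∣p∪q∣≡∣p∣+∣q∣ (inside  ∷ p) (inside  ∷ q) p∩q=∅ = ⊥-elim (p∩q=∅ (zero , here))
∣p∪q∣≡∣p∣+∣q∣ (inside  ∷ p) (outside ∷ q) p∩q=∅ =
  cong suc (∣p∪q∣≡∣p∣+∣q∣ p q (drop-∷-Empty p∩q=∅))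
∣p∪q∣≡∣p∣+∣q∣ (outside ∷ p) (inside  ∷ q) p∩q=∅ =
  trans (cong suc (∣p∪q∣≡∣p∣+∣q∣ p q (drop-∷-Empty p∩q=∅))) (sym (+-suc ∣ p ∣ ∣ q ∣))
∣p∪q∣≡∣p∣+∣q∣ (outside ∷ p) (outside ∷ q) p∩q=∅ =
  ∣p∪q∣≡∣p∣+∣q∣ p q (drop-∷-Empty p∩q=∅)

∣⁅x⁆∪⁅y⁆∣≡2 : ∀ {x y : Fin n} → x ≢ y → ∣ ⁅ x ⁆ ∪ ⁅ y ⁆ ∣ ≡ 2
∣⁅x⁆∪⁅y⁆∣≡2 {x = x} {y} x≢y =
  trans (∣p∪q∣≡∣p∣+∣q∣ ⁅ x ⁆ ⁅ y ⁆ disjoint) (cong₂ _+_ (∣⁅x⁆∣≡1 x) (∣⁅x⁆∣≡1 y))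
  where
  disjoint : Empty (⁅ x ⁆ ∩ ⁅ y ⁆)
  disjoint (z , z∈⁅x⁆∩⁅y⁆) with x∈p∩q⁻ ⁅ x ⁆ ⁅ y ⁆ z∈⁅x⁆∩⁅y⁆
  ... | z∈⁅x⁆ , z∈⁅y⁆ = x≢y (trans (sym (x∈⁅y⁆⇒x≡y x z∈⁅x⁆)) (x∈⁅y⁆⇒x≡y y z∈⁅y⁆))

lookup-⁅x⁆ : ∀ (x y : Fin n) → lookup ⁅ x ⁆ y ≡ does (x ≟ y)
lookup-⁅x⁆ zero    zero    = refl
lookup-⁅x⁆ zero    (suc y) = lookup-replicate y outside
lookup-⁅x⁆ (suc x) zero    = refl
lookup-⁅x⁆ (suc x) (suc y) = lookup-⁅x⁆ x y

pigeonhole-interval : ∀ {m} (f : Fin (suc m) → ℕ) (c : ℕ) →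
                      (∀ i → c ≤ f i) → (∀ i → f i < c + m) →
                      ∃₂ λ i j → i ≢ j × f i ≡ f j
pigeonhole-interval {m} f c c≤f f<c+m = collision (pigeonhole (n<1+n m) (λ i → fromℕ< (f∸c<m i)))
  where
  f∸c<m : ∀ i → f i ∸ c < m
  f∸c<m i = subst (f i ∸ c <_) (m+n∸m≡n c m) (∸-monoˡ-< (f<c+m i) (c≤f i))

  collision : (∃₂ λ i j → i Fin.< j × fromℕ< (f∸c<m i) ≡ fromℕ< (f∸c<m j)) →
              ∃₂ λ i j → i ≢ j × f i ≡ f j
  collision (i , j , i<j , same) =
    i , j , (λ i≡j → <-irrefl (cong toℕ i≡j) i<j) ,
    ∸-cancelʳ-≡ (c≤f i) (c≤f j)
      (trans (sym (toℕ-fromℕ< (f∸c<m i))) (trans (cong toℕ same) (toℕ-fromℕ< (f∸c<m j))))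

neighbours : Graph n → Fin n → Subset n
neighbours G v = tabulate (adj G v)

degree≡∣neighbours∣ : ∀ (G : Graph n) v → degree G v ≡ ∣ neighbours G v ∣
degree≡∣neighbours∣ G v = countᵇ-tabulate (adj G v) id

module _ (G : Graph n) where

  v∉neighbours : ∀ v → v ∉ neighbours G v
  v∉neighbours v v∈ with trans (sym (x∈tabulate⇒ v∈)) (adj-irrefl G v)
  ... | ()

  neighbours-sym : ∀ {u v} → u ∈ neighbours G v → v ∈ neighbours G u
  neighbours-sym {u} {v} u∈ =
    lookup⇒[]= v (neighbours G u)
      (trans (lookup∘tabulate (adj G u) v) (trans (adj-sym G u v) (x∈tabulate⇒ u∈)))

  ∣p∣+degree≤n : ∀ {p} v → Empty (p ∩ neighbours G v) → ∣ p ∣ + degree G v ≤ n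
  ∣p∣+degree≤n {p} v disjoint =
    subst (_≤ n) (trans (∣p∪q∣≡∣p∣+∣q∣ p (neighbours G v) disjoint)
                        (cong (∣ p ∣ +_) (sym (degree≡∣neighbours∣ G v))))
          (∣p∣≤n (p ∪ neighbours G v))

  ⁅v⁆∩neighbours≡∅ : ∀ v → Empty (⁅ v ⁆ ∩ neighbours G v)
  ⁅v⁆∩neighbours≡∅ v (x , x∈) with x∈p∩q⁻ ⁅ v ⁆ (neighbours G v) x∈
  ... | x∈⁅v⁆ , x∈N rewrite x∈⁅y⁆⇒x≡y v x∈⁅v⁆ = v∉neighbours v x∈N

  degree<n : ∀ v → degree G v < n
  degree<n v = subst (λ s → s + degree G v ≤ n) (∣⁅x⁆∣≡1 v) (∣p∣+degree≤n v (⁅v⁆∩neighbours≡∅ v))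

  isolated⇒2+degree≤n : ∀ {v z} → degree G z ≡ 0 → v ≢ z → 2 + degree G v ≤ n
  isolated⇒2+degree≤n {v} {z} isolated v≢z =
    subst (λ s → s + degree G v ≤ n) (∣⁅x⁆∪⁅y⁆∣≡2 v≢z) (∣p∣+degree≤n v disjoint)
    where
    z∉neighbours : ∀ {x} → z ∉ neighbours G x
    z∉neighbours z∈ with subst (0 <_) (trans (sym (degree≡∣neighbours∣ G z)) isolated)
                               (x∈p⇒0<∣p∣ (neighbours-sym z∈))
    ... | ()
    disjoint : Empty ((⁅ v ⁆ ∪ ⁅ z ⁆) ∩ neighbours G v)
    disjoint (x , x∈) with x∈p∩q⁻ (⁅ v ⁆ ∪ ⁅ z ⁆) (neighbours G v) x∈
    ... | x∈⁅v⁆∪⁅z⁆ , x∈N with x∈p∪q⁻ ⁅ v ⁆ ⁅ z ⁆ x∈⁅v⁆∪⁅z⁆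
    ... | inj₁ x∈⁅v⁆ rewrite x∈⁅y⁆⇒x≡y v x∈⁅v⁆ = v∉neighbours v x∈N
    ... | inj₂ x∈⁅z⁆ rewrite x∈⁅y⁆⇒x≡y z x∈⁅z⁆ = z∉neighbours x∈N

  neighbours-complement : ∀ v → neighbours (complement G) v ≡ ∁ (⁅ v ⁆ ∪ neighbours G v)
  neighbours-complement v = begin
    tabulate (adj (complement G) v)
      ≡⟨ tabulate-cong pointwise ⟩
    tabulate (lookup (∁ (⁅ v ⁆ ∪ neighbours G v)))
      ≡⟨ tabulate∘lookup _ ⟩
    ∁ (⁅ v ⁆ ∪ neighbours G v) ∎
    where
    open ≡-Reasoning
    pointwise : ∀ u → adj (complement G) v u ≡ lookup (∁ (⁅ v ⁆ ∪ neighbours G v)) u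
    pointwise u = sym (begin
      lookup (∁ (⁅ v ⁆ ∪ neighbours G v)) u
        ≡⟨ lookup-map u not (⁅ v ⁆ ∪ neighbours G v) ⟩
      not (lookup (⁅ v ⁆ ∪ neighbours G v) u)
        ≡⟨ cong not (lookup-zipWith _∨_ u ⁅ v ⁆ (neighbours G v)) ⟩
      not (lookup ⁅ v ⁆ u ∨ lookup (neighbours G v) u)
        ≡⟨ cong₂ (λ a b → not (a ∨ b)) (lookup-⁅x⁆ v u) (lookup∘tabulate (adj G v) u) ⟩
      not (does (v ≟ u) ∨ adj G v u)
        ≡⟨ deMorgan₂ (does (v ≟ u)) (adj G v u) ⟩
      not (does (v ≟ u)) ∧ not (adj G v u) ∎)

  degree-complement : ∀ v → degree (complement G) v ≡ n ∸ suc (degree G v)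
  degree-complement v = begin
    degree (complement G) v
      ≡⟨ degree≡∣neighbours∣ (complement G) v ⟩
    ∣ neighbours (complement G) v ∣
      ≡⟨ cong ∣_∣ (neighbours-complement v) ⟩
    ∣ ∁ (⁅ v ⁆ ∪ neighbours G v) ∣
      ≡⟨ ∣∁p∣≡n∸∣p∣ (⁅ v ⁆ ∪ neighbours G v) ⟩
    n ∸ ∣ ⁅ v ⁆ ∪ neighbours G v ∣
      ≡⟨ cong (n ∸_) (∣p∪q∣≡∣p∣+∣q∣ ⁅ v ⁆ (neighbours G v) (⁅v⁆∩neighbours≡∅ v)) ⟩
    n ∸ (∣ ⁅ v ⁆ ∣ + ∣ neighbours G v ∣)
      ≡⟨ cong₂ (λ a b → n ∸ (a + b)) (∣⁅x⁆∣≡1 v) (sym (degree≡∣neighbours∣ G v)) ⟩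
    n ∸ suc (degree G v) ∎
    where open ≡-Reasoning

  Independent : Subset n → Set
  Independent S = ∀ {u v} → u ∈ S → v ∈ S → adj G u v ≡ false

  independent⇒KIndependent : ∀ {S} k → Independent S → KIndependent G k S
  independent⇒KIndependent {S} k independent v v∈S =
    ≤-trans (subst₂ _≤_ (sym (countᵇ-tabulate (λ u → inS S u ∧ adj G v u) id)) (∣⊥∣≡0 n)
                        (p⊆q⇒∣p∣≤∣q∣ no-neighbour-in-S))
            z≤n
    where
    no-neighbour-in-S : tabulate (λ u → inS S u ∧ adj G v u) ⊆ ⊥
    no-neighbour-in-S {u} u∈ with x∈tabulate⇒ u∈
    ... | both with trans (sym (∧-conicalʳ _ _ both)) (independent v∈S (inS⇒∈ (∧-conicalˡ _ _ both)))
    ... | ()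

  pair-regular : ∀ {u v} k → adj G u v ≡ false → degree G u ≡ degree G v →
                 RegularKIndependent G k (⁅ u ⁆ ∪ ⁅ v ⁆)
  pair-regular {u} {v} k u≁v same-degree =
    independent⇒KIndependent k independent , degree G u , in-class
    where
    endpoint : ∀ {x} → x ∈ ⁅ u ⁆ ∪ ⁅ v ⁆ → x ≡ u ⊎ x ≡ v
    endpoint x∈ = Sum.map (x∈⁅y⁆⇒x≡y u) (x∈⁅y⁆⇒x≡y v) (x∈p∪q⁻ ⁅ u ⁆ ⁅ v ⁆ x∈)
    independent : Independent (⁅ u ⁆ ∪ ⁅ v ⁆)
    independent x∈ y∈ with endpoint x∈ | endpoint y∈
    ... | inj₁ refl | inj₁ refl = adj-irrefl G u
    ... | inj₁ refl | inj₂ refl = u≁v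
    ... | inj₂ refl | inj₁ refl = trans (adj-sym G v u) u≁v
    ... | inj₂ refl | inj₂ refl = adj-irrefl G v
    in-class : InDegreeClass G (degree G u) (⁅ u ⁆ ∪ ⁅ v ⁆)
    in-class x x∈ with endpoint x∈
    ... | inj₁ refl = refl
    ... | inj₂ refl = sym same-degree

  regKIndepNumber≤n : ∀ {k a} → IsRegKIndepNumber G k a → a ≤ n
  regKIndepNumber≤n ((S , _ , ∣S∣≡a) , _) = subst (_≤ n) ∣S∣≡a (∣p∣≤n S)

  1≤regKIndepNumber : ∀ {k a} → Fin n → IsRegKIndepNumber G k a → 1 ≤ a
  1≤regKIndepNumber {k} v (_ , maximum) =
    ≤-trans (subst (_≤ ∣ ⁅ v ⁆ ∪ ⁅ v ⁆ ∣) (∣⁅x⁆∣≡1 v) (∣p∣≤∣p∪q∣ ⁅ v ⁆ ⁅ v ⁆))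
            (maximum _ (pair-regular k (adj-irrefl G v) refl))

  2≤regKIndepNumber : ∀ {k a u v} → u ≢ v → adj G u v ≡ false → degree G u ≡ degree G v →
                      IsRegKIndepNumber G k a → 2 ≤ a
  2≤regKIndepNumber {k} u≢v u≁v same-degree (_ , maximum) =
    subst (_≤ _) (∣⁅x⁆∪⁅y⁆∣≡2 u≢v) (maximum _ (pair-regular k u≁v same-degree))

  adj⇒complement-non-adj : ∀ {u v} → adj G u v ≡ true → adj (complement G) u v ≡ false
  adj⇒complement-non-adj {u} {v} u∼v =
    trans (cong (λ b → not (does (u ≟ v)) ∧ not b) u∼v) (∧-zeroʳ _)

  degree-complement-cong : ∀ {u v} → degree G u ≡ degree G v →
                           degree (complement G) u ≡ degree (complement G) v
  degree-complement-cong {u} {v} same-degree = begin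
    degree (complement G) u ≡⟨ degree-complement u ⟩
    n ∸ suc (degree G u)    ≡⟨ cong (λ d → n ∸ suc d) same-degree ⟩
    n ∸ suc (degree G v)    ≡⟨ degree-complement v ⟨
    degree (complement G) v ∎
    where open ≡-Reasoning

-- Degrees lie in [0, n - 2] if some vertex is isolated, and in [1, n - 1] otherwise.
repeated-degree : ∀ {m} (G : Graph (suc (suc m))) → ∃₂ λ u v → u ≢ v × degree G u ≡ degree G v
repeated-degree {m} G with any? (λ z → degree G z ≟ℕ 0)
... | yes (z , isolated) = pigeonhole-interval (degree G) 0 (λ _ → z≤n) below
  where
  below : ∀ v → degree G v < suc m
  below v with v ≟ z
  ... | yes refl = subst (_< suc m) (sym isolated) (s≤s z≤n)
  ... | no v≢z   = s≤s⁻¹ (isolated⇒2+degree≤n G isolated v≢z)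
... | no no-isolated =
  pigeonhole-interval (degree G) 1 (λ v → n≢0⇒n>0 (no-isolated ∘ (v ,_))) (degree<n G)

2≤α⊎2≤ᾱ : ∀ {m k a b} (G : Graph (suc (suc m))) →
          IsRegKIndepNumber G k a → IsRegKIndepNumber (complement G) k b → 2 ≤ a ⊎ 2 ≤ b
2≤α⊎2≤ᾱ G α ᾱ with repeated-degree G
... | u , v , u≢v , same-degree with adj G u v in u∼v
... | false = inj₁ (2≤regKIndepNumber G u≢v u∼v same-degree α)
... | true  = inj₂ (2≤regKIndepNumber (complement G) u≢v (adj⇒complement-non-adj G u∼v)
                                      (degree-complement-cong G same-degree) ᾱ)

3≤a+b×2≤a*b : ∀ {a b} → 1 ≤ a → 1 ≤ b → 2 ≤ a ⊎ 2 ≤ b → 3 ≤ a + b × 2 ≤ a * b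
3≤a+b×2≤a*b 1≤a 1≤b (inj₁ 2≤a) = +-mono-≤ 2≤a 1≤b , *-mono-≤ 2≤a 1≤b
3≤a+b×2≤a*b 1≤a 1≤b (inj₂ 2≤b) = +-mono-≤ 1≤a 2≤b , *-mono-≤ 1≤a 2≤b

theorem6p1 : (n k : ℕ) → 2 ≤ n → (G : Graph n) → (a b : ℕ) → IsRegKIndepNumber G k a → IsRegKIndepNumber (complement G) k b → ((3 ≤ a + b × a + b ≤ 2 * n) × (2 ≤ a * b × a * b ≤ n * n))
theorem6p1 n k (s≤s (s≤s _)) G a b α ᾱ =
  (proj₁ lower , a+b≤2n) , (proj₂ lower , *-mono-≤ a≤n b≤n)
  where
  a≤n : a ≤ n
  a≤n = regKIndepNumber≤n G α
  b≤n : b ≤ n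
  b≤n = regKIndepNumber≤n (complement G) ᾱ
  lower : 3 ≤ a + b × 2 ≤ a * b
  lower = 3≤a+b×2≤a*b (1≤regKIndepNumber G zero α) (1≤regKIndepNumber (complement G) zero ᾱ)
                      (2≤α⊎2≤ᾱ G α ᾱ)
  a+b≤2n : a + b ≤ 2 * n
  a+b≤2n = subst (a + b ≤_) (cong (n +_) (sym (+-identityʳ n))) (+-mono-≤ a≤n b≤n)
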